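{- Let $L$ be a bounded lattice and let $f : L \to L$ be a monotone function that is strong, i.e. $x \land f(y) \leq f(x \land y)$ for all $x,y \in L$. Then $f(f(\top)) = f(\top)$. Consequently $f(\top)$ is the greatest fixed point of $f$. -}

module Defs where

open import Level using (Level)
open import Data.Product using (_×_)
open import Relation.Binary.Lattice.Bundles using (BoundedLattice)

module _ {c ℓ₁ ℓ₂ : Level} (L : BoundedLattice c ℓ₁ ℓ₂) where
  open BoundedLattice L

  Monotone : (Carrier → Carrier) → Set _
  Monotone f = ∀ {x y} → x ≤ y → f x ≤ f y

  Strong : (Carrier → Carrier) → Set _
  Strong f = ∀ x y → (x ∧ f y) ≤ f (x ∧ y)

  IsFixedPoint : (Carrier → Carrier) → Carrier → Set _
  IsFixedPoint f g = f g ≈ g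

  IsGreatestFixedPoint : (Carrier → Carrier) → Carrier → Set _
  IsGreatestFixedPoint f g = IsFixedPoint f g × (∀ x → IsFixedPoint f x → x ≤ g)

module Submission where

open import Defs
open import Level using (Level)
open import Data.Product using (_×_; _,_)
open import Relation.Binary.Lattice.Bundles using (BoundedLattice)

-- Strength at y = ⊤ gives x ∧ f ⊤ ≤ f x, which at x = f ⊤ reads f ⊤ ≤ f (f ⊤);
-- monotonicity gives f x ≤ f ⊤ for every x. Hence f ⊤ is a fixed point lying above
-- every fixed point x = f x.

module _ {c ℓ₁ ℓ₂ : Level} (L : BoundedLattice c ℓ₁ ℓ₂)
         {f : BoundedLattice.Carrier L → BoundedLattice.Carrier L} (mono : Monotone L f) where
  open BoundedLattice L

  f≤f⊤ : ∀ x → f x ≤ f ⊤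
  f≤f⊤ x = mono (maximum x)

  fixedPoint≤f⊤ : ∀ x → IsFixedPoint L f x → x ≤ f ⊤
  fixedPoint≤f⊤ x fx≈x = trans (reflexive (Eq.sym fx≈x)) (f≤f⊤ x)

  module _ (strong : Strong L f) where

    x∧f⊤≤f : ∀ x → x ∧ f ⊤ ≤ f x
    x∧f⊤≤f x = trans (strong x ⊤) (mono (x∧y≤x x ⊤))

    f⊤≤ff⊤ : f ⊤ ≤ f (f ⊤)
    f⊤≤ff⊤ = trans (∧-greatest refl refl) (x∧f⊤≤f (f ⊤))

    f⊤-isFixedPoint : IsFixedPoint L f (f ⊤)
    f⊤-isFixedPoint = antisym (f≤f⊤ (f ⊤)) f⊤≤ff⊤

proposition3p7 : {c ℓ₁ ℓ₂ : Level} (L : BoundedLattice c ℓ₁ ℓ₂) (f : BoundedLattice.Carrier L → BoundedLattice.Carrier L) → Monotone L f → Strong L f → BoundedLattice._≈_ L (f (f (BoundedLattice.⊤ L))) (f (BoundedLattice.⊤ L)) × IsGreatestFixedPoint L f (f (BoundedLattice.⊤ L))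
proposition3p7 L f mono strong = fixed , fixed , fixedPoint≤f⊤ L mono
  where
  fixed : IsFixedPoint L f (f (BoundedLattice.⊤ L))
  fixed = f⊤-isFixedPoint L mono strong
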